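{- Let $G=(V,E)$ be a finite, undirected, unweighted, connected graph, $k$ a positive integer, and $D\subseteq V$ a set of vertices with $|V\setminus D|\ge k$ such that every $v\in D$ is dominated by some $u\in V\setminus D$ (i.e. $N[v]\subseteq N[u]$). Let $S\subseteq V$ with $|S|=k$ be such that no swap into $V\setminus D$ improves group farness, i.e. for all $s\in S$ and all $o\in (V\setminus D)\setminus S$ we have $f((S\setminus\{s\})\cup\{o\})\ge f(S)$. Then $f(S)\le 5\, f(S^*)$, equivalently $c(S)\ge \frac15 c(S^*)$, where $S^*$ is an optimal solution, i.e. $f(S^*)=\min\{f(T):T\subseteq V,\ |T|=k\}$. In particular, the swap-based local search that starts from any $k$-set and repeatedly performs improving swaps $(S\setminus\{s\})\cup\{o\}$ with $s\in S$, $o\in (V\setminus D)\setminus S$ until none exists returns a $1/5$-approximation for group closeness centrality maximization.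
   Context: $N[v]=N(v)\cup\{v\}$ is the closed neighborhood. For $S\subseteq V$ nonempty, $\mathrm{dist}(u,S)=\min_{s\in S}\mathrm{dist}(u,s)$, group farness $f(S)=\sum_{u\in V}\mathrm{dist}(u,S)$, and group closeness centrality $c(S)=(|V|-|S|)/f(S)$. Group closeness centrality maximization asks for $S\subseteq V$ with $|S|=k$ maximizing $c(S)$ (equivalently minimizing $f(S)$). -}

module Defs where

open import Data.Nat using (ℕ; zero; suc; _+_)
open import Data.Bool using (Bool; true; false; _∧_; _∨_; if_then_else_)
open import Data.Fin using (Fin; zero; suc)
open import Data.Fin.Subset using (Subset; _∈_; _⊆_)
open import Data.Vec using (lookup; tabulate)
open import Data.Product using (∃)
open import Relation.Nullary.Decidable using (⌊_⌋)
open import Relation.Binary.PropositionalEquality using (_≡_)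
import Data.Fin as F

record Graph (n : ℕ) : Set where
  field
    adj    : Fin n → Fin n → Bool
    sym    : ∀ u v → adj u v ≡ adj v u
    irrefl : ∀ u → adj u u ≡ false
open Graph public

anyFin : ∀ {m} → (Fin m → Bool) → Bool
anyFin {zero}  p = false
anyFin {suc m} p = p zero ∨ anyFin (λ i → p (suc i))

sumFin : ∀ {m} → (Fin m → ℕ) → ℕ
sumFin {zero}  f = 0
sumFin {suc m} f = f zero + sumFin (λ i → f (suc i))

reach : ∀ {n} → Graph n → ℕ → Fin n → Fin n → Bool
reach G zero    u v = ⌊ u F.≟ v ⌋
reach G (suc ℓ) u v = reach G ℓ u v ∨ anyFin (λ w → adj G u w ∧ reach G ℓ w v)

Connected : ∀ {n} → Graph n → Set
Connected {n} G = ∀ (u v : Fin n) → ∃ λ ℓ → reach G ℓ u v ≡ true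

hits : ∀ {n} → Graph n → ℕ → Fin n → Subset n → Bool
hits G ℓ u S = anyFin (λ s → lookup S s ∧ reach G ℓ u s)

search : ∀ {n} → Graph n → Fin n → Subset n → (start fuel : ℕ) → ℕ
search G u S ℓ zero       = ℓ
search G u S ℓ (suc fuel) = if hits G ℓ u S then ℓ else search G u S (suc ℓ) fuel

-- dist(u,S) = min_{s ∈ S} dist(u,s). For connected G and nonempty S this
-- is < n, hence found by the search (fuel n).
distSet : ∀ {n} → Graph n → Fin n → Subset n → ℕ
distSet {n} G u S = search G u S 0 n

farness : ∀ {n} → Graph n → Subset n → ℕ
farness G S = sumFin (λ u → distSet G u S)

closedNbhd : ∀ {n} → Graph n → Fin n → Subset n
closedNbhd G v = tabulate (λ w → ⌊ w F.≟ v ⌋ ∨ adj G v w)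

DominatedBy : ∀ {n} → Graph n → Fin n → Fin n → Set
DominatedBy G v u = closedNbhd G v ⊆ closedNbhd G u

module Submission where

-- Replacing a vertex of D in a k-set by a vertex dominating it (or, if that one is already
-- present, by a fresh vertex outside D) never increases farness, so it suffices to compare S
-- with a k-set O ⊆ V ∖ D, against which S is swap-optimal. Then the single-swap analysis of
-- Arya et al. for k-median applies: with σ j, τ j nearest vertices of S and O to j, weight
-- the swaps (s, o) so that each o ∈ O comes in with total weight W, each s ∈ S goes out with
-- weight at most 2W, and s is σ of no vertex of O other than o. In the weighted sum of the
-- inequalities 0 ≤ f(S − s + o) − f(S), the distance of j rises by at most d(j,O) − d(j,S)
-- in the swaps bringing in τ j, by at most 2 d(j,O) in those removing σ j, and not at all
-- otherwise; hence 0 ≤ W (f(O) − f(S)) + 2W · 2 f(O).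

open import Defs renaming (sym to adj-sym)
open import Data.Nat using (ℕ; zero; suc; _+_; _*_; _∸_; _⊔_; _≤_; _<_; z≤n; s≤s; _≟_; _<?_)
open import Data.Nat.Properties
open import Data.Nat.Tactic.RingSolver using (solve-∀)
open import Data.Bool using (Bool; true; false; _∧_; _∨_; not; if_then_else_)
open import Data.Bool.Properties using (∧-zeroʳ)
open import Data.Fin using (Fin; zero; suc)
import Data.Fin as F
open import Data.Fin.Subset using (Subset; _∈_; _∉_; ∣_∣; ∁; _─_; _∪_; ⁅_⁆)
open import Data.Vec using ([]; _∷_; lookup)
open import Data.Vec.Properties using ([]=⇒lookup; lookup⇒[]=; lookup-replicate; lookup-map; lookup∘tabulate)
open import Data.Product using (∃; _×_; _,_; proj₁; proj₂)
open import Data.Sum using (_⊎_; inj₁; inj₂)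
open import Data.Empty using (⊥-elim)
open import Relation.Nullary using (Dec; yes; no)
open import Relation.Nullary.Decidable using (⌊_⌋)
open import Relation.Binary.PropositionalEquality
open import Function using (_∘_)
open import Algebra.Properties.CommutativeSemigroup +-commutativeSemigroup using (interchange)

[_]·_ : Bool → ℕ → ℕ
[ b ]· x = if b then x else 0

δ : ∀ {n} → Fin n → Fin n → ℕ → ℕ
δ a i x = [ ⌊ a F.≟ i ⌋ ]· x

δ-diag : ∀ {n} (a : Fin n) x → δ a a x ≡ x
δ-diag a x with a F.≟ a
... | yes _ = refl
... | no a≢a = ⊥-elim (a≢a refl)

δ-off : ∀ {n} (a i : Fin n) x → a ≢ i → δ a i x ≡ 0
δ-off a i x a≢i with a F.≟ i
... | yes a≡i = ⊥-elim (a≢i a≡i)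
... | no _ = refl

δ≢0⇒≡ : ∀ {n} (a i : Fin n) x → δ a i x ≢ 0 → a ≡ i
δ≢0⇒≡ a i x δ≢0 with a F.≟ i
... | yes a≡i = a≡i
... | no _ = ⊥-elim (δ≢0 refl)

[]·-+ : ∀ b x y → [ b ]· (x + y) ≡ [ b ]· x + [ b ]· y
[]·-+ true x y = refl
[]·-+ false x y = refl

*-[]· : ∀ c b x → c * [ b ]· x ≡ [ b ]· (c * x)
*-[]· c true x = refl
*-[]· c false x = *-zeroʳ c

[]·-comm : ∀ b c x → [ b ]· [ c ]· x ≡ [ c ]· [ b ]· x
[]·-comm true c x = refl
[]·-comm false true x = refl
[]·-comm false false x = refl

[]·[]·-scale : ∀ b c x → [ b ]· [ c ]· x ≡ x * [ b ]· [ c ]· 1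
[]·[]·-scale true true x = sym (*-identityʳ x)
[]·[]·-scale true false x = sym (*-zeroʳ x)
[]·[]·-scale false c x = sym (*-zeroʳ x)

*-monoʳ-≤-≢0 : ∀ w {L R} → (w ≢ 0 → L ≤ R) → w * L ≤ w * R
*-monoʳ-≤-≢0 zero _ = z≤n
*-monoʳ-≤-≢0 (suc w) L≤R = *-monoʳ-≤ (suc w) (L≤R λ ())

[]·1-pos : ∀ b → 0 < [ b ]· 1 → b ≡ true
[]·1-pos true _ = refl

sumFin-cong : ∀ {m} {f g : Fin m → ℕ} → (∀ i → f i ≡ g i) → sumFin f ≡ sumFin g
sumFin-cong {zero} f≗g = refl
sumFin-cong {suc m} f≗g = cong₂ _+_ (f≗g zero) (sumFin-cong (f≗g ∘ suc))

sumFin-mono : ∀ {m} {f g : Fin m → ℕ} → (∀ i → f i ≤ g i) → sumFin f ≤ sumFin g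
sumFin-mono {zero} f≤g = z≤n
sumFin-mono {suc m} f≤g = +-mono-≤ (f≤g zero) (sumFin-mono (f≤g ∘ suc))

sumFin-zero : ∀ m → sumFin {m} (λ _ → 0) ≡ 0
sumFin-zero zero = refl
sumFin-zero (suc m) = sumFin-zero m

sumFin-+ : ∀ {m} (f g : Fin m → ℕ) → sumFin (λ i → f i + g i) ≡ sumFin f + sumFin g
sumFin-+ {zero} f g = refl
sumFin-+ {suc m} f g rewrite sumFin-+ (f ∘ suc) (g ∘ suc) =
  interchange (f zero) (g zero) (sumFin (f ∘ suc)) (sumFin (g ∘ suc))

sumFin-*ˡ : ∀ {m} c (f : Fin m → ℕ) → sumFin (λ i → c * f i) ≡ c * sumFin f
sumFin-*ˡ {zero} c f = sym (*-zeroʳ c)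
sumFin-*ˡ {suc m} c f rewrite sumFin-*ˡ c (f ∘ suc) = sym (*-distribˡ-+ c (f zero) _)

sumFin-*ʳ : ∀ {m} c (f : Fin m → ℕ) → sumFin (λ i → f i * c) ≡ sumFin f * c
sumFin-*ʳ c f = trans (sumFin-cong (λ i → *-comm (f i) c)) (trans (sumFin-*ˡ c f) (*-comm c _))

sumFin-comm : ∀ {m k} (f : Fin m → Fin k → ℕ) →
  sumFin (λ i → sumFin (λ j → f i j)) ≡ sumFin (λ j → sumFin (λ i → f i j))
sumFin-comm {zero} {k} f = sym (sumFin-zero k)
sumFin-comm {suc m} f rewrite sumFin-comm (f ∘ suc) =
  sym (sumFin-+ (f zero) (λ j → sumFin (λ i → f (suc i) j)))

sumFin-[]· : ∀ {m} b (f : Fin m → ℕ) → sumFin (λ i → [ b ]· f i) ≡ [ b ]· sumFin f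
sumFin-[]· true f = refl
sumFin-[]· {m} false f = sumFin-zero m

sumFin-δ : ∀ {m} (a : Fin m) (f : Fin m → ℕ) → sumFin (λ i → δ a i (f i)) ≡ f a
sumFin-δ {suc m} zero f =
  trans (cong (f zero +_) (trans (sumFin-cong (λ i → δ-off zero (suc i) (f (suc i)) λ ())) (sumFin-zero m)))
        (+-identityʳ _)
sumFin-δ {suc m} (suc a) f =
  trans (cong₂ _+_ (δ-off (suc a) zero (f zero) λ ()) (sumFin-cong δ-suc)) (sumFin-δ a (f ∘ suc))
  where
  δ-suc : ∀ i → δ (suc a) (suc i) (f (suc i)) ≡ δ a i (f (suc i))
  δ-suc i with a F.≟ i
  ... | yes _ = refl
  ... | no _ = refl

≤-sumFin : ∀ {m} (f : Fin m → ℕ) a → f a ≤ sumFin f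
≤-sumFin f zero = m≤m+n _ _
≤-sumFin f (suc a) = ≤-trans (≤-sumFin (f ∘ suc) a) (m≤n+m _ _)

+-≤-sumFin : ∀ {m} (f : Fin m → ℕ) {a b} → a ≢ b → f a + f b ≤ sumFin f
+-≤-sumFin f {zero} {zero} a≢b = ⊥-elim (a≢b refl)
+-≤-sumFin f {zero} {suc b} _ = +-monoʳ-≤ (f zero) (≤-sumFin (f ∘ suc) b)
+-≤-sumFin f {suc a} {zero} _ =
  subst (_≤ sumFin f) (+-comm (f zero) (f (suc a))) (+-monoʳ-≤ (f zero) (≤-sumFin (f ∘ suc) a))
+-≤-sumFin f {suc a} {suc b} a≢b =
  ≤-trans (+-≤-sumFin (f ∘ suc) (a≢b ∘ cong suc)) (m≤n+m _ _)

sumFin-<⇒∃< : ∀ {m} (f g : Fin m → ℕ) → sumFin f < sumFin g → ∃ λ i → f i < g i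
sumFin-<⇒∃< {zero} f g ()
sumFin-<⇒∃< {suc m} f g lt with f zero <? g zero
... | yes p = zero , p
... | no f₀≮g₀ with sumFin-<⇒∃< (f ∘ suc) (g ∘ suc)
                      (+-cancelˡ-< (g zero) _ _ (≤-<-trans (+-monoˡ-≤ _ (≮⇒≥ f₀≮g₀)) lt))
... | i , p = suc i , p

sumFin-pos : ∀ {m} (f : Fin m → ℕ) → 0 < sumFin f → ∃ λ i → 0 < f i
sumFin-pos {m} f pos = sumFin-<⇒∃< (λ _ → 0) f (subst (_< sumFin f) (sym (sumFin-zero m)) pos)

∑∑ : ∀ {n} → (Fin n → Fin n → ℕ) → ℕ
∑∑ f = sumFin (λ s → sumFin (λ o → f s o))

∑∑-+ : ∀ {n} (f g : Fin n → Fin n → ℕ) → ∑∑ (λ s o → f s o + g s o) ≡ ∑∑ f + ∑∑ g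
∑∑-+ f g = trans (sumFin-cong (λ s → sumFin-+ (f s) (g s))) (sumFin-+ (λ s → sumFin (f s)) (λ s → sumFin (g s)))

∑∑-mono : ∀ {n} {f g : Fin n → Fin n → ℕ} → (∀ s o → f s o ≤ g s o) → ∑∑ f ≤ ∑∑ g
∑∑-mono f≤g = sumFin-mono (λ s → sumFin-mono (f≤g s))

∑∑-*ʳ : ∀ {n} (f : Fin n → Fin n → ℕ) x → ∑∑ (λ s o → f s o * x) ≡ ∑∑ f * x
∑∑-*ʳ f x = trans (sumFin-cong (λ s → sumFin-*ʳ x (f s))) (sumFin-*ʳ x (λ s → sumFin (f s)))

∨-true⁻ : ∀ a b → a ∨ b ≡ true → a ≡ true ⊎ b ≡ true
∨-true⁻ true b _ = inj₁ refl
∨-true⁻ false b e = inj₂ e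

∨-true⁺ʳ : ∀ a {b} → b ≡ true → a ∨ b ≡ true
∨-true⁺ʳ true _ = refl
∨-true⁺ʳ false e = e

∧-true⁻ : ∀ a b → a ∧ b ≡ true → a ≡ true × b ≡ true
∧-true⁻ true true _ = refl , refl

false≢true : false ≢ true
false≢true ()

⌊⌋≡true⇒ : ∀ {P : Set} (P? : Dec P) → ⌊ P? ⌋ ≡ true → P
⌊⌋≡true⇒ (yes p) _ = p

anyFin-true⁻ : ∀ {m} (p : Fin m → Bool) → anyFin p ≡ true → ∃ λ i → p i ≡ true
anyFin-true⁻ {suc m} p e with ∨-true⁻ (p zero) _ e
... | inj₁ p₀ = zero , p₀
... | inj₂ rest with anyFin-true⁻ (p ∘ suc) rest
... | i , pᵢ = suc i , pᵢ

anyFin-true⁺ : ∀ {m} (p : Fin m → Bool) i → p i ≡ true → anyFin p ≡ true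
anyFin-true⁺ p zero e rewrite e = refl
anyFin-true⁺ p (suc i) e = ∨-true⁺ʳ (p zero) (anyFin-true⁺ (p ∘ suc) i e)

lookup-∪ : ∀ {n} (p q : Subset n) i → lookup (p ∪ q) i ≡ lookup p i ∨ lookup q i
lookup-∪ (x ∷ p) (y ∷ q) zero = refl
lookup-∪ (x ∷ p) (y ∷ q) (suc i) = lookup-∪ p q i

lookup-─-in : ∀ {n} (p q : Subset n) i → lookup q i ≡ true → lookup (p ─ q) i ≡ false
lookup-─-in (x ∷ p) (true ∷ q) zero _ = refl
lookup-─-in (x ∷ p) (y ∷ q) (suc i) e = lookup-─-in p q i e

lookup-─-out : ∀ {n} (p q : Subset n) i → lookup q i ≡ false → lookup (p ─ q) i ≡ lookup p i
lookup-─-out (x ∷ p) (false ∷ q) zero _ = refl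
lookup-─-out (x ∷ p) (y ∷ q) (suc i) e = lookup-─-out p q i e

lookup-⁅x⁆-x : ∀ {n} (x : Fin n) → lookup ⁅ x ⁆ x ≡ true
lookup-⁅x⁆-x zero = refl
lookup-⁅x⁆-x (suc x) = lookup-⁅x⁆-x x

lookup-⁅x⁆-y : ∀ {n} (x y : Fin n) → x ≢ y → lookup ⁅ x ⁆ y ≡ false
lookup-⁅x⁆-y zero zero x≢y = ⊥-elim (x≢y refl)
lookup-⁅x⁆-y zero (suc y) _ = lookup-replicate y false
lookup-⁅x⁆-y (suc x) zero _ = refl
lookup-⁅x⁆-y (suc x) (suc y) x≢y = lookup-⁅x⁆-y x y (x≢y ∘ cong suc)

lookup-false⇒≢ : ∀ {n} (p : Subset n) {x y} → lookup p x ≡ true → lookup p y ≡ false → x ≢ y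
lookup-false⇒≢ p x∈p y∉p refl = false≢true (trans (sym y∉p) x∈p)

∉⇒lookup-false : ∀ {n} (p : Subset n) x → x ∉ p → lookup p x ≡ false
∉⇒lookup-false p x x∉p with lookup p x in e
... | true = ⊥-elim (x∉p (lookup⇒[]= x p e))
... | false = refl

sumOver : ∀ {n} → Subset n → (Fin n → ℕ) → ℕ
sumOver p h = sumFin (λ i → [ lookup p i ]· h i)

count : ∀ {n} → Subset n → ℕ
count p = sumOver p (λ _ → 1)

∣p∣≡count : ∀ {n} (p : Subset n) → ∣ p ∣ ≡ count p
∣p∣≡count [] = refl
∣p∣≡count (true ∷ p) = cong suc (∣p∣≡count p)
∣p∣≡count (false ∷ p) = ∣p∣≡count p

count-nonempty : ∀ {n} (p : Subset n) → 0 < count p → ∃ λ x → lookup p x ≡ true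
count-nonempty p pos with sumFin-pos (λ i → [ lookup p i ]· 1) pos
... | x , x∈p = x , []·1-pos _ x∈p

swap : ∀ {n} → Subset n → Fin n → Fin n → Subset n
swap T s o = (T ─ ⁅ s ⁆) ∪ ⁅ o ⁆

module _ {n} (T : Subset n) (s o : Fin n) where

  swap-new : lookup (swap T s o) o ≡ true
  swap-new rewrite lookup-∪ (T ─ ⁅ s ⁆) ⁅ o ⁆ o | lookup-⁅x⁆-x o = ∨-true⁺ʳ (lookup (T ─ ⁅ s ⁆) o) refl

  swap-old : s ≢ o → lookup (swap T s o) s ≡ false
  swap-old s≢o rewrite lookup-∪ (T ─ ⁅ s ⁆) ⁅ o ⁆ s | lookup-─-in T ⁅ s ⁆ s (lookup-⁅x⁆-x s)
                     | lookup-⁅x⁆-y o s (s≢o ∘ sym) = refl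

  swap-other : ∀ i → s ≢ i → o ≢ i → lookup (swap T s o) i ≡ lookup T i
  swap-other i s≢i o≢i rewrite lookup-∪ (T ─ ⁅ s ⁆) ⁅ o ⁆ i | lookup-─-out T ⁅ s ⁆ i (lookup-⁅x⁆-y s i s≢i)
                             | lookup-⁅x⁆-y o i o≢i with lookup T i
  ... | true = refl
  ... | false = refl

  swap-keep : ∀ i → lookup T i ≡ true → s ≢ i → lookup (swap T s o) i ≡ true
  swap-keep i i∈T s≢i with o F.≟ i
  ... | yes refl = swap-new
  ... | no o≢i = trans (swap-other i s≢i o≢i) i∈T

  swap-⊆ : lookup T o ≡ true → ∀ i → lookup (swap T s o) i ≡ true → lookup T i ≡ true
  swap-⊆ o∈T i i∈T′ with o F.≟ i
  ... | yes refl = o∈T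
  ... | no o≢i with s F.≟ i
  ... | yes refl = ⊥-elim (false≢true (trans (sym (swap-old (o≢i ∘ sym))) i∈T′))
  ... | no s≢i = trans (sym (swap-other i s≢i o≢i)) i∈T′

  sumOver-swap : lookup T s ≡ true → lookup T o ≡ false → (h : Fin n → ℕ) →
    sumOver (swap T s o) h + h s ≡ sumOver T h + h o
  sumOver-swap s∈T o∉T h = begin
      sumOver (swap T s o) h + h s
    ≡⟨ cong (sumOver (swap T s o) h +_) (sym (sumFin-δ s h)) ⟩
      sumOver (swap T s o) h + sumFin (λ i → δ s i (h i))
    ≡⟨ sym (sumFin-+ (λ i → [ lookup (swap T s o) i ]· h i) (λ i → δ s i (h i))) ⟩
      sumFin (λ i → [ lookup (swap T s o) i ]· h i + δ s i (h i))
    ≡⟨ sumFin-cong pointwise ⟩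
      sumFin (λ i → [ lookup T i ]· h i + δ o i (h i))
    ≡⟨ sumFin-+ (λ i → [ lookup T i ]· h i) (λ i → δ o i (h i)) ⟩
      sumOver T h + sumFin (λ i → δ o i (h i))
    ≡⟨ cong (sumOver T h +_) (sumFin-δ o h) ⟩
      sumOver T h + h o
    ∎
    where
    open ≡-Reasoning
    s≢o : s ≢ o
    s≢o = lookup-false⇒≢ T s∈T o∉T
    pointwise : ∀ i → [ lookup (swap T s o) i ]· h i + δ s i (h i) ≡ [ lookup T i ]· h i + δ o i (h i)
    pointwise i with o F.≟ i
    ... | yes refl rewrite swap-new | o∉T | δ-off s o (h o) s≢o = +-identityʳ (h o)
    ... | no o≢i with s F.≟ i
    ... | yes refl rewrite swap-old s≢o | s∈T = sym (+-identityʳ (h s))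
    ... | no s≢i rewrite swap-other i s≢i o≢i = refl

  count-swap : lookup T s ≡ true → lookup T o ≡ false → count (swap T s o) ≡ count T
  count-swap s∈T o∉T = +-cancelʳ-≡ 1 _ _ (sumOver-swap s∈T o∉T (λ _ → 1))

module Distance {n} (G : Graph n) where

  reach-refl : ∀ ℓ u → reach G ℓ u u ≡ true
  reach-refl zero u with u F.≟ u
  ... | yes _ = refl
  ... | no u≢u = ⊥-elim (u≢u refl)
  reach-refl (suc ℓ) u rewrite reach-refl ℓ u = refl

  reach-zero⁻ : ∀ {u v} → reach G 0 u v ≡ true → u ≡ v
  reach-zero⁻ {u} {v} r with u F.≟ v
  ... | yes u≡v = u≡v
  ... | no _ = ⊥-elim (false≢true r)

  reach-suc : ∀ ℓ u v → reach G ℓ u v ≡ true → reach G (suc ℓ) u v ≡ true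
  reach-suc ℓ u v r rewrite r = refl

  reach-mono : ∀ {ℓ m} u v → ℓ ≤ m → reach G ℓ u v ≡ true → reach G m u v ≡ true
  reach-mono {ℓ} {m} u v ℓ≤m r = subst (λ k → reach G k u v ≡ true) (m∸n+n≡m ℓ≤m) (pad (m ∸ ℓ))
    where
    pad : ∀ d → reach G (d + ℓ) u v ≡ true
    pad zero = r
    pad (suc d) = reach-suc (d + ℓ) u v (pad d)

  reach-step : ∀ ℓ u x v → adj G u x ≡ true → reach G ℓ x v ≡ true → reach G (suc ℓ) u v ≡ true
  reach-step ℓ u x v ux r =
    ∨-true⁺ʳ (reach G ℓ u v) (anyFin-true⁺ (λ w → adj G u w ∧ reach G ℓ w v) x (cong₂ _∧_ ux r))

  reach-trans : ∀ ℓ m u v w → reach G ℓ u v ≡ true → reach G m v w ≡ true → reach G (ℓ + m) u w ≡ true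
  reach-trans zero m u v w p q with reach-zero⁻ p
  ... | refl = q
  reach-trans (suc ℓ) m u v w p q with ∨-true⁻ (reach G ℓ u v) _ p
  ... | inj₁ r = reach-suc (ℓ + m) u w (reach-trans ℓ m u v w r q)
  ... | inj₂ a with anyFin-true⁻ _ a
  ... | x , e with ∧-true⁻ (adj G u x) (reach G ℓ x v) e
  ... | ux , r = reach-step (ℓ + m) u x w ux (reach-trans ℓ m x v w r q)

  reach-sym : ∀ ℓ u v → reach G ℓ u v ≡ true → reach G ℓ v u ≡ true
  reach-sym zero u v p with reach-zero⁻ p
  ... | refl = p
  reach-sym (suc ℓ) u v p with ∨-true⁻ (reach G ℓ u v) _ p
  ... | inj₁ r = reach-suc ℓ v u (reach-sym ℓ u v r)
  ... | inj₂ a with anyFin-true⁻ _ a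
  ... | x , e with ∧-true⁻ (adj G u x) (reach G ℓ x v) e
  ... | ux , r = subst (λ k → reach G k v u ≡ true) (+-comm ℓ 1)
        (reach-trans ℓ 1 v x u (reach-sym ℓ x v r) (reach-step 0 x u u (trans (adj-sym G x u) ux) (reach-refl 0 u)))

  -- distSet searches only up to n, so it is the distance truncated at n, and Within ℓ u v
  -- says that the truncated distance is at most ℓ.
  Within : ℕ → Fin n → Fin n → Set
  Within ℓ u v = reach G ℓ u v ≡ true ⊎ n ≤ ℓ

  within-refl : ∀ ℓ u → Within ℓ u u
  within-refl ℓ u = inj₁ (reach-refl ℓ u)

  within-zero⁻ : ∀ {u v} → Within 0 u v → u ≡ v
  within-zero⁻ (inj₁ r) = reach-zero⁻ r
  within-zero⁻ {()} (inj₂ z≤n)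

  within-mono : ∀ {ℓ m u v} → ℓ ≤ m → Within ℓ u v → Within m u v
  within-mono ℓ≤m (inj₁ r) = inj₁ (reach-mono _ _ ℓ≤m r)
  within-mono ℓ≤m (inj₂ n≤ℓ) = inj₂ (≤-trans n≤ℓ ℓ≤m)

  within-trans : ∀ ℓ m {u v w} → Within ℓ u v → Within m v w → Within (ℓ + m) u w
  within-trans ℓ m {u} {v} {w} (inj₁ p) (inj₁ q) = inj₁ (reach-trans ℓ m u v w p q)
  within-trans ℓ m (inj₂ n≤ℓ) _ = inj₂ (≤-trans n≤ℓ (m≤m+n ℓ m))
  within-trans ℓ m _ (inj₂ n≤m) = inj₂ (≤-trans n≤m (m≤n+m m ℓ))

  within-sym : ∀ ℓ {u v} → Within ℓ u v → Within ℓ v u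
  within-sym ℓ {u} {v} (inj₁ r) = inj₁ (reach-sym ℓ u v r)
  within-sym ℓ (inj₂ n≤ℓ) = inj₂ n≤ℓ

  search-hit-or-exhausted : ∀ u S ℓ₀ fuel →
    hits G (search G u S ℓ₀ fuel) u S ≡ true ⊎ search G u S ℓ₀ fuel ≡ ℓ₀ + fuel
  search-hit-or-exhausted u S ℓ₀ zero = inj₂ (sym (+-identityʳ ℓ₀))
  search-hit-or-exhausted u S ℓ₀ (suc fuel) with hits G ℓ₀ u S in hit
  ... | true = inj₁ hit
  ... | false with search-hit-or-exhausted u S (suc ℓ₀) fuel
  ... | inj₁ h = inj₁ h
  ... | inj₂ e = inj₂ (trans e (sym (+-suc ℓ₀ fuel)))

  search-≤-hit : ∀ u S ℓ₀ fuel ℓ → ℓ₀ ≤ ℓ → hits G ℓ u S ≡ true → search G u S ℓ₀ fuel ≤ ℓ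
  search-≤-hit u S ℓ₀ zero ℓ ℓ₀≤ℓ _ = ℓ₀≤ℓ
  search-≤-hit u S ℓ₀ (suc fuel) ℓ ℓ₀≤ℓ h with hits G ℓ₀ u S in miss
  ... | true = ℓ₀≤ℓ
  ... | false with ℓ₀ ≟ ℓ
  ... | yes refl = ⊥-elim (false≢true (trans (sym miss) h))
  ... | no ℓ₀≢ℓ = search-≤-hit u S (suc ℓ₀) fuel ℓ (≤∧≢⇒< ℓ₀≤ℓ ℓ₀≢ℓ) h

  search-≤-fuel : ∀ u S ℓ₀ fuel → search G u S ℓ₀ fuel ≤ ℓ₀ + fuel
  search-≤-fuel u S ℓ₀ zero = ≤-reflexive (sym (+-identityʳ ℓ₀))
  search-≤-fuel u S ℓ₀ (suc fuel) with hits G ℓ₀ u S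
  ... | true = m≤m+n ℓ₀ (suc fuel)
  ... | false = ≤-trans (search-≤-fuel u S (suc ℓ₀) fuel) (≤-reflexive (sym (+-suc ℓ₀ fuel)))

  distSet-attained : ∀ u S {t} → lookup S t ≡ true →
    ∃ λ s → lookup S s ≡ true × Within (distSet G u S) u s
  distSet-attained u S {t} t∈S with search-hit-or-exhausted u S 0 n
  ... | inj₂ capped = t , t∈S , inj₂ (≤-reflexive (sym capped))
  ... | inj₁ h with anyFin-true⁻ _ h
  ... | s , e with ∧-true⁻ (lookup S s) _ e
  ... | s∈S , r = s , s∈S , inj₁ r

  distSet-≤ : ∀ u S {t ℓ} → lookup S t ≡ true → Within ℓ u t → distSet G u S ≤ ℓ
  distSet-≤ u S {t} {ℓ} t∈S (inj₁ r) = search-≤-hit u S 0 n ℓ z≤n (anyFin-true⁺ _ t (cong₂ _∧_ t∈S r))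
  distSet-≤ u S t∈S (inj₂ n≤ℓ) = ≤-trans (search-≤-fuel u S 0 n) n≤ℓ

  distSet-pos : ∀ u S {t} → lookup S t ≡ true → lookup S u ≡ false → 0 < distSet G u S
  distSet-pos u S t∈S u∉S with distSet-attained u S t∈S
  ... | s , s∈S , w with distSet G u S
  ... | suc _ = s≤s z≤n
  ... | zero with within-zero⁻ w
  ... | refl = ⊥-elim (false≢true (trans (sym u∉S) s∈S))

  distSet-antitone : ∀ u S T {t} → lookup T t ≡ true →
    (∀ i → lookup T i ≡ true → lookup S i ≡ true) → distSet G u S ≤ distSet G u T
  distSet-antitone u S T t∈T T⊆S with distSet-attained u T t∈T
  ... | s , s∈T , w = distSet-≤ u S (T⊆S s s∈T) w

  farness-antitone : ∀ S T {t} → lookup T t ≡ true →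
    (∀ i → lookup T i ≡ true → lookup S i ≡ true) → farness G S ≤ farness G T
  farness-antitone S T t∈T T⊆S = sumFin-mono (λ u → distSet-antitone u S T t∈T T⊆S)

module Domination {n} (G : Graph n) where
  open Distance G

  closedNbhd-dominated : ∀ {v u} → DominatedBy G v u → ∀ w →
    (⌊ w F.≟ v ⌋ ∨ adj G v w) ≡ true → (⌊ w F.≟ u ⌋ ∨ adj G u w) ≡ true
  closedNbhd-dominated {v} {u} v≤u w e =
    trans (sym (lookup∘tabulate (λ w → ⌊ w F.≟ u ⌋ ∨ adj G u w) w))
      ([]=⇒lookup (v≤u (lookup⇒[]= w _ (trans (lookup∘tabulate (λ w → ⌊ w F.≟ v ⌋ ∨ adj G v w) w) e))))

  -- The vertex before v on a walk x … w v lies in N(v) ⊆ N[u], so the walk can be redirected to u.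
  reach-dominator : ∀ {v u} → DominatedBy G v u → ∀ ℓ x → x ≢ v →
    reach G ℓ x v ≡ true → reach G ℓ x u ≡ true
  reach-dominator v≤u zero x x≢v r = ⊥-elim (x≢v (reach-zero⁻ r))
  reach-dominator {v} {u} v≤u (suc ℓ) x x≢v r with ∨-true⁻ (reach G ℓ x v) _ r
  ... | inj₁ r′ = reach-suc ℓ x u (reach-dominator v≤u ℓ x x≢v r′)
  ... | inj₂ a with anyFin-true⁻ _ a
  ... | w , e with ∧-true⁻ (adj G x w) (reach G ℓ w v) e
  ... | xw , r′ with w F.≟ v
  ... | no w≢v = reach-step ℓ x w u xw (reach-dominator v≤u ℓ w w≢v r′)
  ... | yes refl with ∨-true⁻ ⌊ x F.≟ u ⌋ _ (closedNbhd-dominated v≤u x (∨-true⁺ʳ ⌊ x F.≟ w ⌋ (trans (adj-sym G w x) xw)))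
  ... | inj₂ ux = reach-step ℓ x u u (trans (adj-sym G x u) ux) (reach-refl ℓ u)
  ... | inj₁ x≟u with x F.≟ u
  ... | yes refl = reach-refl (suc ℓ) x
  ... | no _ = ⊥-elim (false≢true x≟u)

  within-dominator : ∀ {v u} → DominatedBy G v u → ∀ ℓ x → x ≢ v → Within ℓ x v → Within ℓ x u
  within-dominator v≤u ℓ x x≢v (inj₁ r) = inj₁ (reach-dominator v≤u ℓ x x≢v r)
  within-dominator v≤u ℓ x x≢v (inj₂ n≤ℓ) = inj₂ n≤ℓ

  within-one-dominator : ∀ {v u} → DominatedBy G v u → v ≢ u → Within 1 v u
  within-one-dominator {v} {u} v≤u v≢u
    with ∨-true⁻ ⌊ v F.≟ u ⌋ _ (closedNbhd-dominated v≤u v (cong (_∨ adj G v v) (reach-refl 0 v)))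
  ... | inj₂ uv = inj₁ (reach-step 0 v u u (trans (adj-sym G v u) uv) (reach-refl 0 u))
  ... | inj₁ v≟u with v F.≟ u
  ... | yes v≡u = ⊥-elim (v≢u v≡u)
  ... | no _ = ⊥-elim (false≢true v≟u)

  module _ (T : Subset n) {v u y : Fin n} (v∈T : lookup T v ≡ true) (y∉T : lookup T y ≡ false)
           (v≤u : DominatedBy G v u) (v≢u : v ≢ u) (u∈T′ : lookup (swap T v y) u ≡ true) where

    private
      T′ : Subset n
      T′ = swap T v y
      v≢y : v ≢ y
      v≢y = lookup-false⇒≢ T v∈T y∉T

    distSet-swap-dominated : ∀ x → v ≢ x → distSet G x T′ ≤ distSet G x T
    distSet-swap-dominated x v≢x with distSet-attained x T v∈T
    ... | t , t∈T , w with v F.≟ t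
    ... | yes refl = distSet-≤ x T′ u∈T′ (within-dominator v≤u _ x (v≢x ∘ sym) w)
    ... | no v≢t = distSet-≤ x T′ (swap-keep T v y t t∈T v≢t) w

    farness-swap-dominated : farness G T′ ≤ farness G T
    farness-swap-dominated = +-cancelʳ-≤ 1 _ _ (subst₂ _≤_
      (trans (sumFin-+ (λ x → distSet G x T′) (λ x → δ y x 1)) (cong (farness G T′ +_) (sumFin-δ y (λ _ → 1))))
      (trans (sumFin-+ (λ x → distSet G x T) (λ x → δ v x 1)) (cong (farness G T +_) (sumFin-δ v (λ _ → 1))))
      (sumFin-mono pointwise))
      where
      pointwise : ∀ x → distSet G x T′ + δ y x 1 ≤ distSet G x T + δ v x 1
      pointwise x with y F.≟ x
      ... | yes refl rewrite δ-off v y 1 v≢y =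
        ≤-trans (+-monoˡ-≤ 1 (distSet-≤ y T′ (swap-new T v y) (within-refl 0 y)))
                (≤-trans (distSet-pos y T v∈T y∉T) (≤-reflexive (sym (+-identityʳ _))))
      ... | no y≢x with v F.≟ x
      ... | yes refl = ≤-trans (≤-reflexive (+-identityʳ _))
                         (≤-trans (distSet-≤ v T′ u∈T′ (within-one-dominator v≤u v≢u)) (m≤n+m 1 _))
      ... | no v≢x = +-mono-≤ (distSet-swap-dominated x v≢x) z≤n

countIn : ∀ {n} → Subset n → Subset n → ℕ
countIn D T = sumOver T (λ i → [ lookup D i ]· 1)

[]·[]·1-pos : ∀ a b → 0 < [ a ]· [ b ]· 1 → a ≡ true × b ≡ true
[]·[]·1-pos true true _ = refl , refl

count-split : ∀ {n} (D T : Subset n) →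
  count T ≡ sumOver T (λ i → [ not (lookup D i) ]· 1) + countIn D T
count-split {n} D T = trans (sumFin-cong (λ i → pointwise (lookup T i) (lookup D i))) (sumFin-+ {n} _ _)
  where
  pointwise : ∀ a b → [ a ]· 1 ≡ [ a ]· [ not b ]· 1 + [ a ]· [ b ]· 1
  pointwise true true = refl
  pointwise true false = refl
  pointwise false b = refl

count-∁ : ∀ {n} (D : Subset n) → count (∁ D) ≡ sumFin (λ i → [ not (lookup D i) ]· 1)
count-∁ D = sumFin-cong (λ i → cong ([_]· 1) (lookup-map i not D))

outside-both : ∀ {n} (D T : Subset n) → count T ≤ count (∁ D) → 0 < countIn D T →
  ∃ λ y → lookup T y ≡ false × lookup D y ≡ false
outside-both D T T≤∁D T∩D≢∅ with sumFin-<⇒∃< (λ i → [ lookup T i ]· [ not (lookup D i) ]· 1)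
                                           (λ i → [ not (lookup D i) ]· 1) fewer
  where
  fewer : sumOver T (λ i → [ not (lookup D i) ]· 1) < sumFin (λ i → [ not (lookup D i) ]· 1)
  fewer = begin-strict
      sumOver T (λ i → [ not (lookup D i) ]· 1)
    <⟨ m<m+n _ T∩D≢∅ ⟩
      sumOver T (λ i → [ not (lookup D i) ]· 1) + countIn D T
    ≡⟨ sym (count-split D T) ⟩
      count T
    ≤⟨ T≤∁D ⟩
      count (∁ D)
    ≡⟨ count-∁ D ⟩
      sumFin (λ i → [ not (lookup D i) ]· 1)
    ∎
    where open ≤-Reasoning
... | y , lt = y , outside (lookup T y) (lookup D y) lt
  where
  outside : ∀ a b → [ a ]· [ not b ]· 1 < [ not b ]· 1 → a ≡ false × b ≡ false
  outside false false _ = refl , refl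
  outside true false (s≤s ())

module Reduction {n} (G : Graph n) (D : Subset n)
  (dominator : ∀ v → lookup D v ≡ true → ∃ λ u → lookup D u ≡ false × DominatedBy G v u) where
  open Domination G

  Avoids : Subset n → Set
  Avoids O = ∀ i → lookup O i ≡ true → lookup D i ≡ false

  countIn-swap : ∀ T {v y} → lookup T v ≡ true → lookup T y ≡ false →
    lookup D v ≡ true → lookup D y ≡ false → countIn D (swap T v y) + 1 ≡ countIn D T
  countIn-swap T {v} {y} v∈T y∉T v∈D y∉D =
    trans (cong (countIn D (swap T v y) +_) (sym (cong ([_]· 1) v∈D)))
          (trans (sumOver-swap T v y v∈T y∉T (λ i → [ lookup D i ]· 1))
                 (trans (cong (countIn D T +_) (cong ([_]· 1) y∉D)) (+-identityʳ _)))

  avoids : ∀ T → countIn D T ≡ 0 → Avoids T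
  avoids T none i i∈T with lookup D i in i∈D
  ... | false = refl
  ... | true = ⊥-elim (1+n≰n (subst (_≤ 0) (cong₂ (λ a b → [ a ]· [ b ]· 1) i∈T i∈D)
                  (≤-trans (≤-sumFin (λ i → [ lookup T i ]· [ lookup D i ]· 1) i) (≤-reflexive none))))

  -- Swap a dominated v ∈ T for a vertex y outside T ∪ D that leaves v's dominator u in the set:
  -- y = u if u ∉ T, otherwise any free vertex outside D, which exists as ∣T∣ ≤ ∣V ∖ D∣.
  undominate : ∀ m T → countIn D T ≡ m → count T ≤ count (∁ D) →
    ∃ λ O → count O ≡ count T × Avoids O × farness G O ≤ farness G T
  undominate zero T none _ = T , refl , avoids T none , ≤-refl
  undominate (suc m) T cm T≤∁D
    with sumFin-pos (λ i → [ lookup T i ]· [ lookup D i ]· 1) (subst (0 <_) (sym cm) (s≤s z≤n))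
  ... | v , pos with []·[]·1-pos (lookup T v) (lookup D v) pos
  ... | v∈T , v∈D with dominator v v∈D
  ... | u , u∉D , v≤u with replacement
    where
    v≢u : v ≢ u
    v≢u = lookup-false⇒≢ D v∈D u∉D
    replacement : ∃ λ y → lookup T y ≡ false × lookup D y ≡ false × lookup (swap T v y) u ≡ true
    replacement with lookup T u in u∈?T
    ... | false = u , u∈?T , u∉D , swap-new T v u
    ... | true with outside-both D T T≤∁D (subst (0 <_) (sym cm) (s≤s z≤n))
    ... | y , y∉T , y∉D = y , y∉T , y∉D , swap-keep T v y u u∈?T v≢u
  ... | y , y∉T , y∉D , u∈T′ with undominate m (swap T v y)
          (suc-injective (trans (+-comm 1 _) (trans (countIn-swap T v∈T y∉T v∈D y∉D) cm)))
          (≤-trans (≤-reflexive (count-swap T v y v∈T y∉T)) T≤∁D)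
  ... | O , O≡ , O∩D≡∅ , O≤ =
    O , trans O≡ (count-swap T v y v∈T y∉T) , O∩D≡∅ ,
    ≤-trans O≤ (farness-swap-dominated T v∈T y∉T v≤u (lookup-false⇒≢ D v∈D u∉D) u∈T′)

module SwapAnalysis {n} (G : Graph n) (S O : Subset n) {s₀ o₀ : Fin n}
                    (s₀∈S : lookup S s₀ ≡ true) (o₀∈O : lookup O o₀ ≡ true) where
  open Distance G

  a b : Fin n → ℕ
  a j = distSet G j S
  b j = distSet G j O

  σ : Fin n → Fin n
  σ j = proj₁ (distSet-attained j S s₀∈S)

  σ∈S : ∀ j → lookup S (σ j) ≡ true
  σ∈S j = proj₁ (proj₂ (distSet-attained j S s₀∈S))

  within-σ : ∀ j → Within (a j) j (σ j)
  within-σ j = proj₂ (proj₂ (distSet-attained j S s₀∈S))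

  τ : Fin n → Fin n
  τ j = proj₁ (distSet-attained j O o₀∈O)

  τ∈O : ∀ j → lookup O (τ j) ≡ true
  τ∈O j = proj₁ (proj₂ (distSet-attained j O o₀∈O))

  within-τ : ∀ j → Within (b j) j (τ j)
  within-τ j = proj₂ (proj₂ (distSet-attained j O o₀∈O))

  CapturesOnly : Fin n → Fin n → Set
  CapturesOnly s o = ∀ o′ → lookup O o′ ≡ true → σ o′ ≡ s → o′ ≡ o

  -- After swapping s out for o, a vertex j with τ j = o moves to o; one with σ j = s and
  -- τ j ≠ o moves to σ (τ j), which differs from s because s captures only o, and lies
  -- within b j + a (τ j) ≤ b j + (b j + a j) of j; every other vertex keeps σ j.
  distSet-swap : ∀ s o → CapturesOnly s o → ∀ j →
    distSet G j (swap S s o) + δ (τ j) o (a j) ≤ a j + δ (τ j) o (b j) + δ (σ j) s (2 * b j)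
  distSet-swap s o captures j with τ j F.≟ o
  ... | yes τj≡o =
    ≤-trans (+-monoˡ-≤ (a j) (distSet-≤ j (swap S s o) (swap-new S s o) (subst (Within (b j) j) τj≡o (within-τ j))))
            (≤-trans (≤-reflexive (+-comm (b j) (a j))) (m≤m+n _ _))
  ... | no τj≢o with σ j F.≟ s
  ... | no σj≢s =
    ≤-trans (≤-reflexive (+-identityʳ _))
      (≤-trans (distSet-≤ j (swap S s o) (swap-keep S s o (σ j) (σ∈S j) (σj≢s ∘ sym)) (within-σ j))
               (≤-trans (≤-reflexive (sym (+-identityʳ _))) (m≤m+n _ _)))
  ... | yes _ =
    ≤-trans (≤-reflexive (+-identityʳ _)) (≤-trans via-τ (≤-reflexive (rearrange (a j) (b j))))
    where
    s≢στj : s ≢ σ (τ j)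
    s≢στj s≡ = τj≢o (captures (τ j) (τ∈O j) (sym s≡))
    a-τ : a (τ j) ≤ b j + a j
    a-τ = distSet-≤ (τ j) S (σ∈S j)
            (within-trans (b j) (a j) (within-sym (b j) (within-τ j)) (within-σ j))
    via-τ : distSet G j (swap S s o) ≤ b j + (b j + a j)
    via-τ = distSet-≤ j (swap S s o) (swap-keep S s o (σ (τ j)) (σ∈S (τ j)) s≢στj)
              (within-mono (+-monoʳ-≤ (b j) a-τ) (within-trans (b j) (a (τ j)) (within-τ j) (within-σ (τ j))))
    rearrange : ∀ a b → b + (b + a) ≡ a + 0 + 2 * b
    rearrange = solve-∀

  module Weighted (w : Fin n → Fin n → ℕ) (W : ℕ)
    (improving : ∀ s o → w s o ≢ 0 → farness G S ≤ farness G (swap S s o))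
    (captures : ∀ s o → w s o ≢ 0 → CapturesOnly s o)
    (inflow : ∀ o → lookup O o ≡ true → sumFin (λ s → w s o) ≡ W)
    (outflow : ∀ s → sumFin (λ o → w s o) ≤ 2 * W) where

    total : ℕ
    total = ∑∑ w

    weightedDist : Fin n → Fin n → Fin n → ℕ
    weightedDist j s o = w s o * distSet G j (swap S s o)

    ∑∑-inflow : ∀ t x → lookup O t ≡ true → ∑∑ (λ s o → δ t o (w s o * x)) ≡ W * x
    ∑∑-inflow t x t∈O = trans (sumFin-cong (λ s → sumFin-δ t (λ o → w s o * x)))
                       (trans (sumFin-*ʳ x (λ s → w s t)) (cong (_* x) (inflow t t∈O)))

    ∑∑-outflow : ∀ t x → ∑∑ (λ s o → δ t s (w s o * x)) ≤ (2 * W) * x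
    ∑∑-outflow t x = ≤-trans (≤-reflexive (trans (sumFin-cong (λ s → sumFin-[]· ⌊ t F.≟ s ⌋ (λ o → w s o * x)))
                                        (trans (sumFin-δ t (λ s → sumFin (λ o → w s o * x))) (sumFin-*ʳ x (w t)))))
                         (*-monoˡ-≤ x (outflow t))

    weightedDist-≤ : ∀ j → ∑∑ (weightedDist j) + W * a j ≤ total * a j + W * b j + (2 * W) * (2 * b j)
    weightedDist-≤ j = begin
        ∑∑ (weightedDist j) + W * a j
      ≡⟨ cong (∑∑ (weightedDist j) +_) (sym (∑∑-inflow (τ j) (a j) (τ∈O j))) ⟩
        ∑∑ (weightedDist j) + ∑∑ (λ s o → δ (τ j) o (w s o * a j))
      ≡⟨ sym (∑∑-+ (weightedDist j) (λ s o → δ (τ j) o (w s o * a j))) ⟩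
        ∑∑ (λ s o → weightedDist j s o + δ (τ j) o (w s o * a j))
      ≤⟨ ∑∑-mono pointwise ⟩
        ∑∑ (λ s o → (w s o * a j + δ (τ j) o (w s o * b j)) + δ (σ j) s (w s o * (2 * b j)))
      ≡⟨ trans (∑∑-+ (λ s o → w s o * a j + δ (τ j) o (w s o * b j)) (λ s o → δ (σ j) s (w s o * (2 * b j))))
               (cong (_+ ∑∑ (λ s o → δ (σ j) s (w s o * (2 * b j))))
                     (∑∑-+ (λ s o → w s o * a j) (λ s o → δ (τ j) o (w s o * b j)))) ⟩
        (∑∑ (λ s o → w s o * a j) + ∑∑ (λ s o → δ (τ j) o (w s o * b j))) + ∑∑ (λ s o → δ (σ j) s (w s o * (2 * b j)))
      ≤⟨ +-mono-≤ (≤-reflexive (cong₂ _+_ (∑∑-*ʳ w (a j)) (∑∑-inflow (τ j) (b j) (τ∈O j)))) (∑∑-outflow (σ j) (2 * b j)) ⟩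
        total * a j + W * b j + (2 * W) * (2 * b j)
      ∎
      where
      open ≤-Reasoning
      pointwise : ∀ s o → weightedDist j s o + δ (τ j) o (w s o * a j)
                          ≤ (w s o * a j + δ (τ j) o (w s o * b j)) + δ (σ j) s (w s o * (2 * b j))
      pointwise s o = subst₂ _≤_
        (trans (*-distribˡ-+ (w s o) _ _) (cong (weightedDist j s o +_) (*-[]· (w s o) _ (a j))))
        (trans (*-distribˡ-+ (w s o) _ _)
               (cong₂ _+_ (trans (*-distribˡ-+ (w s o) _ _) (cong (w s o * a j +_) (*-[]· (w s o) _ (b j))))
                          (*-[]· (w s o) _ (2 * b j))))
        (*-monoʳ-≤-≢0 (w s o) (λ w≢0 → distSet-swap s o (captures s o w≢0) j))

    total-≤-swaps : total * farness G S ≤ sumFin (λ j → ∑∑ (weightedDist j))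
    total-≤-swaps = begin
        total * farness G S
      ≡⟨ sym (∑∑-*ʳ w (farness G S)) ⟩
        ∑∑ (λ s o → w s o * farness G S)
      ≤⟨ ∑∑-mono (λ s o → *-monoʳ-≤-≢0 (w s o) (improving s o)) ⟩
        ∑∑ (λ s o → w s o * farness G (swap S s o))
      ≡⟨ sumFin-cong (λ s → sumFin-cong (λ o → sym (sumFin-*ˡ (w s o) (λ j → distSet G j (swap S s o))))) ⟩
        ∑∑ (λ s o → sumFin (λ j → weightedDist j s o))
      ≡⟨ sumFin-cong (λ s → sym (sumFin-comm (λ j o → weightedDist j s o))) ⟩
        sumFin (λ s → sumFin (λ j → sumFin (λ o → weightedDist j s o)))
      ≡⟨ sym (sumFin-comm (λ j s → sumFin (λ o → weightedDist j s o))) ⟩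
        sumFin (λ j → ∑∑ (weightedDist j))
      ∎
      where open ≤-Reasoning

    total+W*farness-≤ : total * farness G S + W * farness G S ≤ total * farness G S + W * (5 * farness G O)
    total+W*farness-≤ = begin
        total * fS + W * fS
      ≤⟨ +-monoˡ-≤ (W * fS) total-≤-swaps ⟩
        sumFin (λ j → ∑∑ (weightedDist j)) + W * fS
      ≡⟨ cong (sumFin (λ j → ∑∑ (weightedDist j)) +_) (sym (sumFin-*ˡ W a)) ⟩
        sumFin (λ j → ∑∑ (weightedDist j)) + sumFin (λ j → W * a j)
      ≡⟨ sym (sumFin-+ (λ j → ∑∑ (weightedDist j)) (λ j → W * a j)) ⟩
        sumFin (λ j → ∑∑ (weightedDist j) + W * a j)
      ≤⟨ sumFin-mono weightedDist-≤ ⟩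
        sumFin (λ j → total * a j + W * b j + (2 * W) * (2 * b j))
      ≡⟨ trans (sumFin-+ (λ j → total * a j + W * b j) (λ j → (2 * W) * (2 * b j)))
          (cong₂ _+_ (trans (sumFin-+ (λ j → total * a j) (λ j → W * b j)) (cong₂ _+_ (sumFin-*ˡ total a) (sumFin-*ˡ W b)))
            (trans (sumFin-*ˡ (2 * W) (λ j → 2 * b j)) (cong ((2 * W) *_) (sumFin-*ˡ 2 b)))) ⟩
        total * fS + W * fO + (2 * W) * (2 * fO)
      ≡⟨ trans (+-assoc (total * fS) _ _) (cong (total * fS +_) (collect W fO)) ⟩
        total * fS + W * (5 * fO)
      ∎
      where
      open ≤-Reasoning
      fS fO : ℕ
      fS = farness G S
      fO = farness G O
      collect : ∀ W x → W * x + 2 * W * (2 * x) ≡ W * (5 * x)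
      collect = solve-∀

    farness-≤-5* : 0 < W → farness G S ≤ 5 * farness G O
    farness-≤-5* (s≤s {n = W-1} _) = *-cancelˡ-≤ (suc W-1) (+-cancelˡ-≤ (total * farness G S) _ _ total+W*farness-≤)

-- Every o ∈ O spreads weight W over the swaps (s, o): if o is the only vertex captured by
-- σ o (o is lonely), all of it goes to (σ o, o); otherwise 1 goes to each idle s (capturing
-- nothing), which needs W ≥ #idle. An idle s then receives at most #shared ≤ 2 #idle ≤ 2W.
module LocalOptimum {n} (G : Graph n) (S O D : Subset n) {s₀ o₀ : Fin n}
    (s₀∈S : lookup S s₀ ≡ true) (o₀∈O : lookup O o₀ ≡ true)
    (O∩D≡∅ : ∀ i → lookup O i ≡ true → lookup D i ≡ false)
    (locallyOptimal : ∀ s o → lookup S s ≡ true → lookup D o ≡ false → lookup S o ≡ false →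
                      farness G S ≤ farness G (swap S s o))
    (∣S∣≡∣O∣ : count S ≡ count O) where
  open Distance G
  open SwapAnalysis G S O s₀∈S o₀∈O

  captured : Fin n → ℕ
  captured s = sumOver O (λ o → δ (σ o) s 1)

  lonely : Fin n → Bool
  lonely o = ⌊ captured (σ o) ≟ 1 ⌋

  idle : Fin n → Bool
  idle s = lookup S s ∧ ⌊ captured s ≟ 0 ⌋

  #idle #shared : ℕ
  #idle = sumFin (λ s → [ idle s ]· 1)
  #shared = sumOver O (λ o → [ not (lonely o) ]· 1)

  W : ℕ
  W = 1 ⊔ #idle

  w : Fin n → Fin n → ℕ
  w s o = [ lookup O o ]· ([ lonely o ]· δ (σ o) s W + [ not (lonely o) ]· [ idle s ]· 1)

  sumOver-σ : ∀ (h : Fin n → ℕ) → sumOver O (λ o → h (σ o)) ≡ sumFin (λ s → h s * captured s)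
  sumOver-σ h = begin
      sumFin (λ o → [ lookup O o ]· h (σ o))
    ≡⟨ sumFin-cong (λ o → cong ([ lookup O o ]·_) (sym (sumFin-δ (σ o) h))) ⟩
      sumFin (λ o → [ lookup O o ]· sumFin (λ s → δ (σ o) s (h s)))
    ≡⟨ sumFin-cong (λ o → sym (sumFin-[]· (lookup O o) (λ s → δ (σ o) s (h s)))) ⟩
      sumFin (λ o → sumFin (λ s → [ lookup O o ]· δ (σ o) s (h s)))
    ≡⟨ sumFin-comm (λ o s → [ lookup O o ]· δ (σ o) s (h s)) ⟩
      sumFin (λ s → sumFin (λ o → [ lookup O o ]· δ (σ o) s (h s)))
    ≡⟨ sumFin-cong (λ s → trans (sumFin-cong (λ o → []·[]·-scale (lookup O o) ⌊ σ o F.≟ s ⌋ (h s)))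
                                (sumFin-*ˡ (h s) (λ o → [ lookup O o ]· δ (σ o) s 1))) ⟩
      sumFin (λ s → h s * captured s)
    ∎
    where open ≡-Reasoning

  captured-summand : ∀ o → lookup O o ≡ true → [ lookup O o ]· δ (σ o) (σ o) 1 ≡ 1
  captured-summand o o∈O = trans (cong ([_]· δ (σ o) (σ o) 1) o∈O) (δ-diag (σ o) 1)

  captured-pos : ∀ o → lookup O o ≡ true → 0 < captured (σ o)
  captured-pos o o∈O = ≤-trans (≤-reflexive (sym (captured-summand o o∈O)))
                         (≤-sumFin (λ o′ → [ lookup O o′ ]· δ (σ o′) (σ o) 1) o)

  captured-two : ∀ {o o′} → o ≢ o′ → lookup O o ≡ true → lookup O o′ ≡ true → σ o′ ≡ σ o →
    2 ≤ captured (σ o)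
  captured-two {o} {o′} o≢o′ o∈O o′∈O σo′≡σo = ≤-trans
    (≤-reflexive (sym (cong₂ _+_ (captured-summand o o∈O)
                                 (trans (cong (λ t → [ lookup O o′ ]· δ (σ o′) t 1) (sym σo′≡σo)) (captured-summand o′ o′∈O)))))
    (+-≤-sumFin (λ o″ → [ lookup O o″ ]· δ (σ o″) (σ o) 1) o≢o′)

  w≢0⁻ : ∀ s o → w s o ≢ 0 →
    lookup O o ≡ true × ((lonely o ≡ true × σ o ≡ s) ⊎ (lonely o ≡ false × idle s ≡ true))
  w≢0⁻ s o w≢0 = cases (lookup O o) (lonely o) (idle s) w≢0
    where
    cases : ∀ bO bℓ bᵢ → [ bO ]· ([ bℓ ]· δ (σ o) s W + [ not bℓ ]· [ bᵢ ]· 1) ≢ 0 →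
      bO ≡ true × ((bℓ ≡ true × σ o ≡ s) ⊎ (bℓ ≡ false × bᵢ ≡ true))
    cases true true bᵢ ≢0 = refl , inj₁ (refl , δ≢0⇒≡ (σ o) s W (≢0 ∘ trans (+-identityʳ _)))
    cases true false true _ = refl , inj₂ (refl , refl)
    cases true false false ≢0 = ⊥-elim (≢0 refl)
    cases false bℓ bᵢ ≢0 = ⊥-elim (≢0 refl)

  captures : ∀ s o → w s o ≢ 0 → CapturesOnly s o
  captures s o w≢0 o′ o′∈O σo′≡s with o′ F.≟ o
  ... | yes o′≡o = o′≡o
  ... | no o′≢o with w≢0⁻ s o w≢0
  ... | o∈O , inj₁ (lonely-o , refl) =
    ⊥-elim (1+n≰n (subst (2 ≤_) (⌊⌋≡true⇒ (captured (σ o) ≟ 1) lonely-o) (captured-two (o′≢o ∘ sym) o∈O o′∈O σo′≡s)))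
  ... | _ , inj₂ (_ , idle-s) =
    ⊥-elim (1+n≰n (subst (1 ≤_) (⌊⌋≡true⇒ (captured s ≟ 0) (proj₂ (∧-true⁻ (lookup S s) _ idle-s)))
                         (subst (λ t → 0 < captured t) σo′≡s (captured-pos o′ o′∈O))))

  improving : ∀ s o → w s o ≢ 0 → farness G S ≤ farness G (swap S s o)
  improving s o w≢0 with w≢0⁻ s o w≢0
  ... | o∈O , why with lookup S o in o∈?S
  ... | false = locallyOptimal s o (s∈S why) (O∩D≡∅ o o∈O) o∈?S
    where
    s∈S : (lonely o ≡ true × σ o ≡ s) ⊎ (lonely o ≡ false × idle s ≡ true) → lookup S s ≡ true
    s∈S (inj₁ (_ , refl)) = σ∈S o
    s∈S (inj₂ (_ , idle-s)) = proj₁ (∧-true⁻ (lookup S s) _ idle-s)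
  ... | true = farness-antitone S (swap S s o) (swap-new S s o) (swap-⊆ S s o o∈?S)

  count-O : count O ≡ sumFin captured
  count-O = trans (sumOver-σ (λ _ → 1)) (sumFin-cong (λ s → *-identityˡ (captured s)))

  -- Summed over s, the shared vertices of O number Σ_{captured s ≥ 2} captured s, and
  -- each such s forces at least captured s − 1 ≥ captured s / 2 idle vertices since ∣S∣ = ∣O∣.
  #shared-≤ : #shared ≤ 2 * #idle
  #shared-≤ = +-cancelʳ-≤ (2 * count S) #shared (2 * #idle) (begin
      #shared + 2 * count S
    ≡⟨ cong₂ _+_ (sumOver-σ (λ s → [ not ⌊ captured s ≟ 1 ⌋ ]· 1)) (sym (sumFin-*ˡ 2 (λ s → [ lookup S s ]· 1))) ⟩
      sumFin (λ s → [ not ⌊ captured s ≟ 1 ⌋ ]· 1 * captured s) + sumFin (λ s → 2 * [ lookup S s ]· 1)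
    ≡⟨ sym (sumFin-+ (λ s → [ not ⌊ captured s ≟ 1 ⌋ ]· 1 * captured s) (λ s → 2 * [ lookup S s ]· 1)) ⟩
      sumFin (λ s → [ not ⌊ captured s ≟ 1 ⌋ ]· 1 * captured s + 2 * [ lookup S s ]· 1)
    ≤⟨ sumFin-mono (λ s → pointwise (lookup S s) (captured s)) ⟩
      sumFin (λ s → 2 * [ idle s ]· 1 + 2 * captured s)
    ≡⟨ trans (sumFin-+ (λ s → 2 * [ idle s ]· 1) (λ s → 2 * captured s))
             (cong₂ _+_ (sumFin-*ˡ 2 (λ s → [ idle s ]· 1)) (sumFin-*ˡ 2 captured)) ⟩
      2 * #idle + 2 * sumFin captured
    ≡⟨ cong (λ t → 2 * #idle + 2 * t) (sym (trans ∣S∣≡∣O∣ count-O)) ⟩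
      2 * #idle + 2 * count S
    ∎)
    where
    open ≤-Reasoning
    pointwise : ∀ b p → [ not ⌊ p ≟ 1 ⌋ ]· 1 * p + 2 * [ b ]· 1 ≤ 2 * [ b ∧ ⌊ p ≟ 0 ⌋ ]· 1 + 2 * p
    pointwise false p = ≤-trans (≤-reflexive (+-identityʳ _)) (*-monoˡ-≤ p (at-most-2 p))
      where
      at-most-2 : ∀ p → [ not ⌊ p ≟ 1 ⌋ ]· 1 ≤ 2
      at-most-2 p with ⌊ p ≟ 1 ⌋
      ... | true = z≤n
      ... | false = s≤s z≤n
    pointwise true zero = ≤-refl
    pointwise true (suc zero) = ≤-refl
    pointwise true (suc (suc r)) = subst₂ _≤_ (lhs r) (rhs r) (m≤m+n (r + 4) r)
      where
      lhs : ∀ r → r + 4 ≡ 1 * (2 + r) + 2 * 1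
      lhs = solve-∀
      rhs : ∀ r → r + 4 + r ≡ 2 * 0 + 2 * (2 + r)
      rhs = solve-∀

  inflow : ∀ o → lookup O o ≡ true → sumFin (λ s → w s o) ≡ W
  inflow o o∈O = trans (sumFin-cong (λ s → cong (λ b → [ b ]· ([ lonely o ]· δ (σ o) s W + [ not (lonely o) ]· [ idle s ]· 1)) o∈O))
                       (by-kind (lonely o) refl)
    where
    by-kind : ∀ ℓ → lonely o ≡ ℓ → sumFin (λ s → [ ℓ ]· δ (σ o) s W + [ not ℓ ]· [ idle s ]· 1) ≡ W
    by-kind true _ = trans (sumFin-cong {n} (λ s → +-identityʳ _)) (sumFin-δ (σ o) (λ _ → W))
    by-kind false shared = sym (m≤n⇒m⊔n≡n (idle-pos #idle #shared-≤))
      where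
      shared-pos : 1 ≤ #shared
      shared-pos = ≤-trans (≤-reflexive (sym (cong₂ (λ b c → [ b ]· [ not c ]· 1) o∈O shared)))
                           (≤-sumFin (λ o → [ lookup O o ]· [ not (lonely o) ]· 1) o)
      idle-pos : ∀ i → #shared ≤ 2 * i → 1 ≤ i
      idle-pos zero ≤0 = ⊥-elim (1+n≰n (≤-trans shared-pos ≤0))
      idle-pos (suc _) _ = s≤s z≤n

  outflow : ∀ s → sumFin (λ o → w s o) ≤ 2 * W
  outflow s = begin
      sumFin (λ o → w s o)
    ≡⟨ trans (sumFin-cong (λ o → []·-+ (lookup O o) _ _)) (sumFin-+ lonely-part shared-part) ⟩
      sumFin lonely-part + sumFin shared-part
    ≤⟨ +-mono-≤ (sumFin-mono lonely-≤) (≤-reflexive (sumFin-cong shared-≡)) ⟩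
      sumFin (λ o → [ ⌊ captured s ≟ 1 ⌋ ]· (W * [ lookup O o ]· δ (σ o) s 1))
        + sumFin (λ o → [ idle s ]· [ lookup O o ]· [ not (lonely o) ]· 1)
    ≡⟨ cong₂ _+_ (trans (sumFin-[]· ⌊ captured s ≟ 1 ⌋ (λ o → W * [ lookup O o ]· δ (σ o) s 1))
                        (cong ([ ⌊ captured s ≟ 1 ⌋ ]·_) (sumFin-*ˡ W (λ o → [ lookup O o ]· δ (σ o) s 1))))
                 (sumFin-[]· (idle s) (λ o → [ lookup O o ]· [ not (lonely o) ]· 1)) ⟩
      [ ⌊ captured s ≟ 1 ⌋ ]· (W * captured s) + [ idle s ]· #shared
    ≤⟨ by-captured (captured s) (lookup S s) (≤-trans #shared-≤ (*-monoʳ-≤ 2 (m≤n⊔m 1 #idle))) ⟩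
      2 * W
    ∎
    where
    open ≤-Reasoning
    lonely-part shared-part : Fin n → ℕ
    lonely-part o = [ lookup O o ]· [ lonely o ]· δ (σ o) s W
    shared-part o = [ lookup O o ]· [ not (lonely o) ]· [ idle s ]· 1

    lonely-≤ : ∀ o → lonely-part o ≤ [ ⌊ captured s ≟ 1 ⌋ ]· (W * [ lookup O o ]· δ (σ o) s 1)
    lonely-≤ o = bound (lookup O o) (lonely o) (σ o F.≟ s)
                   (λ σo≡s → subst (λ t → ⌊ captured t ≟ 1 ⌋ ≡ true) σo≡s)
      where
      bound : ∀ b ℓ (σo≟s : Dec (σ o ≡ s)) → (σ o ≡ s → ℓ ≡ true → ⌊ captured s ≟ 1 ⌋ ≡ true) →
        [ b ]· [ ℓ ]· [ ⌊ σo≟s ⌋ ]· W ≤ [ ⌊ captured s ≟ 1 ⌋ ]· (W * [ b ]· [ ⌊ σo≟s ⌋ ]· 1)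
      bound false ℓ _ _ = z≤n
      bound true false _ _ = z≤n
      bound true true (no _) _ = z≤n
      bound true true (yes σo≡s) lonely-s rewrite lonely-s σo≡s refl = ≤-reflexive (sym (*-identityʳ W))

    shared-≡ : ∀ o → shared-part o ≡ [ idle s ]· [ lookup O o ]· [ not (lonely o) ]· 1
    shared-≡ o = trans (cong ([ lookup O o ]·_) ([]·-comm (not (lonely o)) (idle s) 1))
                       ([]·-comm (lookup O o) (idle s) _)

    by-captured : ∀ c b → #shared ≤ 2 * W → [ ⌊ c ≟ 1 ⌋ ]· (W * c) + [ b ∧ ⌊ c ≟ 0 ⌋ ]· #shared ≤ 2 * W
    by-captured zero true ≤2W = ≤2W
    by-captured zero false _ = z≤n
    by-captured (suc zero) b _ rewrite ∧-zeroʳ b =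
      ≤-trans (≤-reflexive (trans (+-identityʳ (W * 1)) (*-identityʳ W))) (m≤m+n W _)
    by-captured (suc (suc _)) b _ rewrite ∧-zeroʳ b = z≤n

  farness-≤-5*farness : farness G S ≤ 5 * farness G O
  farness-≤-5*farness = Weighted.farness-≤-5* w W improving captures inflow outflow (m≤m⊔n 1 #idle)

mainTheorem3 : ∀ {n} (G : Graph n) → Connected G →
    (k : ℕ) → 1 ≤ k →
    (D : Subset n) → k ≤ ∣ ∁ D ∣ →
    (∀ v → v ∈ D → ∃ λ u → u ∉ D × DominatedBy G v u) →
    (S : Subset n) → ∣ S ∣ ≡ k →
    (∀ s o → s ∈ S → o ∉ D → o ∉ S →
      farness G S ≤ farness G ((S ─ ⁅ s ⁆) ∪ ⁅ o ⁆)) →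
    (Sstar : Subset n) → ∣ Sstar ∣ ≡ k →
    (∀ T → ∣ T ∣ ≡ k → farness G Sstar ≤ farness G T) →
    farness G S ≤ 5 * farness G Sstar
mainTheorem3 G _ k 1≤k D k≤∣∁D∣ dominated S ∣S∣≡k locallyOptimal Sstar ∣S*∣≡k _
  with Reduction.undominate G D dominator (countIn D Sstar) Sstar refl
         (subst₂ _≤_ (trans (sym ∣S*∣≡k) (∣p∣≡count Sstar)) (∣p∣≡count (∁ D)) k≤∣∁D∣)
  where
  dominator : ∀ v → lookup D v ≡ true → ∃ λ u → lookup D u ≡ false × DominatedBy G v u
  dominator v v∈D with dominated v (lookup⇒[]= v D v∈D)
  ... | u , u∉D , v≤u = u , ∉⇒lookup-false D u u∉D , v≤u
... | O , ∣O∣≡∣S*∣ , O∩D≡∅ , O≤S* =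
  ≤-trans (LocalOptimum.farness-≤-5*farness G S O D (proj₂ s₀) (proj₂ o₀) O∩D≡∅ locallyOptimal′ ∣S∣≡∣O∣)
          (*-monoʳ-≤ 5 O≤S*)
  where
  ∣S∣≡∣O∣ : count S ≡ count O
  ∣S∣≡∣O∣ = trans (sym (∣p∣≡count S)) (trans ∣S∣≡k (trans (sym ∣S*∣≡k) (trans (∣p∣≡count Sstar) (sym ∣O∣≡∣S*∣))))
  0<∣S∣ : 0 < count S
  0<∣S∣ = subst (0 <_) (trans (sym ∣S∣≡k) (∣p∣≡count S)) 1≤k
  s₀ : ∃ λ s → lookup S s ≡ true
  s₀ = count-nonempty S 0<∣S∣
  o₀ : ∃ λ o → lookup O o ≡ true
  o₀ = count-nonempty O (subst (0 <_) ∣S∣≡∣O∣ 0<∣S∣)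
  locallyOptimal′ : ∀ s o → lookup S s ≡ true → lookup D o ≡ false → lookup S o ≡ false →
                    farness G S ≤ farness G (swap S s o)
  locallyOptimal′ s o s∈S o∉D o∉S =
    locallyOptimal s o (lookup⇒[]= s S s∈S)
      (λ o∈D → false≢true (trans (sym o∉D) ([]=⇒lookup o∈D)))
      (λ o∈S → false≢true (trans (sym o∉S) ([]=⇒lookup o∈S)))
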